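{- Let $C$ be a non-empty finite set. To every bijection $f:A\times C\to B\times C$ with $A,B$ finite sets one can associate a bijection $\bar f:A\times C\to B\times C$ which is parallel, i.e. $\bar f((a,c))=(\bar f_c(a),c)$ for all $(a,c)\in A\times C$, where $\bar f_c:A\to B$ is a bijection for each $c\in C$, and such that the association is fully equivariant: whenever $(\alpha,\beta,\gamma)\in S(A)\times S(B)\times S(C)$ satisfies $f_{\alpha,\beta,\gamma}=f$, one also has $\bar f_{\alpha,\beta,\gamma}=\bar f$.
   Context: Composition of functions is written $p \lhd q$ ("$p$ then $q$"), meaning $(p\lhd q)(x)=q(p(x))$. For a bijection $g:A\times C\to B\times C$ and $(\alpha,\beta,\gamma)\in S(A)\times S(B)\times S(C)$, $g_{\alpha,\beta,\gamma}=(\alpha^{ -1}\times\gamma^{ -1})\lhd g\lhd(\beta\times\gamma)$. -}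

module Defs where

open import Data.Nat using (ℕ)
open import Data.Fin using (Fin)
open import Data.Product using (_×_; _,_; Σ; map)
open import Function.Bundles using (_↔_; Inverse)
open import Data.Fin.Permutation using (Permutation′; _⟨$⟩ʳ_; _⟨$⟩ˡ_)
open import Relation.Binary.PropositionalEquality using (_≡_; _≗_)

Bij : ℕ → ℕ → ℕ → Set
Bij a b c = (Fin a × Fin c) ↔ (Fin b × Fin c)

app : ∀ {a b c} → Bij a b c → Fin a × Fin c → Fin b × Fin c
app f = Inverse.to f

-- g_{α,β,γ} = (α⁻¹ × γ⁻¹) ⊲ g ⊲ (β × γ)   (⊲ = "first ... then ...")
-- i.e. g_{α,β,γ}(x , z) = (β × γ) (g (α⁻¹ x , γ⁻¹ z))
twist : ∀ {a b c} → (Fin a × Fin c → Fin b × Fin c) →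
        Permutation′ a → Permutation′ b → Permutation′ c →
        (Fin a × Fin c → Fin b × Fin c)
twist g α β γ p = map (β ⟨$⟩ʳ_) (γ ⟨$⟩ʳ_) (g (map (α ⟨$⟩ˡ_) (γ ⟨$⟩ˡ_) p))

IsParallel : ∀ {a b c} → Bij a b c → Set
IsParallel {a} {b} {c} h =
  Σ (Fin c → Fin a ↔ Fin b) λ hc → ∀ x z → app h (x , z) ≡ (Inverse.to (hc z) x , z)

Equivariant : ∀ {a b c} → Bij a b c → Bij a b c → Set
Equivariant {a} {b} {c} f fbar =
  (α : Permutation′ a) (β : Permutation′ b) (γ : Permutation′ c) →
  twist (app f) α β γ ≗ app f → twist (app fbar) α β γ ≗ app fbar

-- The symmetries of f form a finite group G acting on A, B and C, and f is a G-equivariant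
-- bijection A × C → B × C.  We build a G-equivariant injection h : A × C → B × C preserving
-- the C-coordinate.  Its fibres h_z : A → B are injective and |A| = |B|, so they are
-- bijections, f̄ (u , z) = (h_z u , z) is parallel, and f̄ commutes with G because h does.
--
-- h is built orbit by orbit.  X ⊆ A × C and Y ⊆ B × C have the same marks if, for every list
-- K of elements of G and every z ∈ C fixed by K, the fibres of X and Y over z contain equally
-- many K-fixed points; f gives A × C and B × C the same marks.  Then a point x ∈ X with a
-- largest stabiliser has a partner y ∈ Y in its fibre with the same stabiliser, g • x ↦ g • y
-- matches their orbits, the orbits have equal marks, and we recurse on the complements.
module Submission where

open import Defs
open import Data.Nat using (ℕ; zero; suc; _+_; _*_; _≤_; _<_; z≤n; s≤s; s≤s⁻¹; _≤?_; >-nonZero)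
open import Data.Nat.Properties
  using (≤-refl; ≤-reflexive; ≤-trans; ≤-antisym; <⇒≤; <⇒≱; ≰⇒>; ≤-<-trans; m≤n⇒m≤1+n; +-suc; +-cancelˡ-≡; *-cancelʳ-≡; m≤n+m; +-monoˡ-≤)
open import Data.Bool using (Bool; true; false; _∧_; not; if_then_else_) renaming (_≟_ to _≟ᵇ_)
open import Data.List using (List; []; _∷_; _++_; map; allFin; cartesianProduct; cartesianProductWith; filter; length)
open import Data.List.Properties using (length-tabulate)
open import Data.List.Membership.Propositional using (_∈_; find; lose)
open import Data.List.Membership.Propositional.Properties
  using (∈-allFin; ∈-cartesianProduct⁺; ∈-cartesianProductWith⁺; ∈-filter⁺; ∈-filter⁻)
open import Data.List.Relation.Unary.Any using (Any; here; there; any?)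
open import Data.List.Relation.Unary.All using (all?)
import Data.List.Relation.Unary.All as All
open import Data.List.Relation.Unary.All.Properties using (all-filter)
open import Data.List.Relation.Unary.Unique.Propositional using (Unique)
open import Data.List.Relation.Unary.AllPairs using (_∷_)
open import Data.List.Relation.Unary.Unique.Propositional.Properties using (allFin⁺; cartesianProduct⁺)
open import Data.List.Extrema.Nat using (argmax; argmax-all; f[xs]≤f[argmax])
open import Data.Product using (Σ; _×_; _,_; proj₁; proj₂)
import Data.Product as Product
open import Function.Bundles using (_↔_; Inverse; mk↔ₛ′)
open import Data.Product.Properties using (≡-dec)
open import Data.Empty using (⊥; ⊥-elim)
open import Data.Sum using (_⊎_; inj₁; inj₂)
open import Data.Fin using (Fin; _≟_; punchOut) renaming (zero to fzero)
import Data.Fin.Properties as Fin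
open import Data.Vec using (Vec; lookup; tabulate)
import Data.Vec as Vec
open import Data.Vec.Properties using (lookup∘tabulate)
open import Data.Fin.Permutation using (Permutation′; _⟨$⟩ʳ_; _⟨$⟩ˡ_; inverseˡ; inverseʳ)
open import Relation.Nullary using (Dec; yes; no)
open import Relation.Nullary.Decidable using (does; dec-true; recompute; _×-dec_)
open import Data.Refinement using (Refinement; _,_; value)
open import Data.Irrelevant using ([_])
open import Relation.Binary.Definitions using (DecidableEquality)
open import Relation.Binary.PropositionalEquality

-- Subsets of finite sets are handled as Boolean characteristic functions; these are the
-- Boolean facts needed to manipulate them.
true≢false : true ≡ false → ⊥
true≢false ()

true-or-false : (b : Bool) → b ≡ true ⊎ b ≡ false
true-or-false true  = inj₁ refl
true-or-false false = inj₂ refl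

does⇒ : {P : Set} (d : Dec P) → does d ≡ true → P
does⇒ (yes p) _ = p

∧-elimˡ : ∀ {a b} → a ∧ b ≡ true → a ≡ true
∧-elimˡ {true} _ = refl

∧-elimʳ : ∀ {a b} → a ∧ b ≡ true → b ≡ true
∧-elimʳ {true} e = e

∧-intro : ∀ {a b} → a ≡ true → b ≡ true → a ∧ b ≡ true
∧-intro refl refl = refl

∧-not-intro : ∀ {a b} → a ≡ true → b ≡ false → a ∧ not b ≡ true
∧-not-intro refl refl = refl

∧-not-elimʳ : ∀ {a b} → a ∧ not b ≡ true → b ≡ false
∧-not-elimʳ {true} {false} _ = refl

bool-ext : {a b : Bool} → (a ≡ true → b ≡ true) → (b ≡ true → a ≡ true) → a ≡ b
bool-ext {true}  {true}  _ _ = refl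
bool-ext {true}  {false} f _ = sym (f refl)
bool-ext {false} {true}  _ g = g refl
bool-ext {false} {false} _ _ = refl

∧-restrict : ∀ x f o → (o ≡ true → x ≡ true) → (x ∧ f) ∧ o ≡ o ∧ f
∧-restrict true  true  true  _ = refl
∧-restrict true  true  false _ = refl
∧-restrict true  false true  _ = refl
∧-restrict true  false false _ = refl
∧-restrict false f     true  h with () ← h refl
∧-restrict false true  false _ = refl
∧-restrict false false false _ = refl

∧-remove : ∀ x f o → (x ∧ f) ∧ not o ≡ (x ∧ not o) ∧ f
∧-remove true  true  true  = refl
∧-remove true  true  false = refl
∧-remove true  false true  = refl
∧-remove true  false false = refl
∧-remove false f     o     = refl

count : {X : Set} → (X → Bool) → List X → ℕ
count P [] = 0
count P (x ∷ xs) with P x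
... | true  = suc (count P xs)
... | false = count P xs

module _ {X : Set} where

  count-cong : (P Q : X → Bool) (xs : List X) → (∀ x → x ∈ xs → P x ≡ Q x) → count P xs ≡ count Q xs
  count-cong P Q [] _ = refl
  count-cong P Q (x ∷ xs) e with P x | Q x | e x (here refl)
  ... | true  | true  | _ = cong suc (count-cong P Q xs (λ y m → e y (there m)))
  ... | false | false | _ = count-cong P Q xs (λ y m → e y (there m))

  count-split : (P Q : X → Bool) (xs : List X) →
    count P xs ≡ count (λ x → P x ∧ Q x) xs + count (λ x → P x ∧ not (Q x)) xs
  count-split P Q [] = refl
  count-split P Q (x ∷ xs) with P x | Q x
  ... | true  | true  = cong suc (count-split P Q xs)
  ... | true  | false = trans (cong suc (count-split P Q xs)) (sym (+-suc _ _))
  ... | false | true  = count-split P Q xs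
  ... | false | false = count-split P Q xs

  count-witness : (P : X → Bool) (xs : List X) → 0 < count P xs → Σ X λ x → x ∈ xs × P x ≡ true
  count-witness P (x ∷ xs) pos with P x in eq
  ... | true  = x , here refl , eq
  ... | false = let (y , m , p) = count-witness P xs pos in y , there m , p

  count-pos : (P : X → Bool) (xs : List X) {x : X} → x ∈ xs → P x ≡ true → 0 < count P xs
  count-pos P (y ∷ xs) (here refl) px with P y
  count-pos P (y ∷ xs) (here refl) refl | true = s≤s z≤n
  count-pos P (y ∷ xs) (there m) px with P y
  ... | true  = s≤s z≤n
  ... | false = count-pos P xs m px

  Included : (P Q : X → Bool) → List X → Set
  Included P Q xs = ∀ x → x ∈ xs → P x ≡ true → Q x ≡ true

  count-mono : (P Q : X → Bool) (xs : List X) → Included P Q xs → count P xs ≤ count Q xs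
  count-mono P Q [] _ = z≤n
  count-mono P Q (x ∷ xs) i with P x in ep | Q x in eq
  ... | true  | true  = s≤s (count-mono P Q xs (λ y m → i y (there m)))
  ... | false | true  = m≤n⇒m≤1+n (count-mono P Q xs (λ y m → i y (there m)))
  ... | false | false = count-mono P Q xs (λ y m → i y (there m))
  ... | true  | false = ⊥-elim (true≢false (trans (sym (i x (here refl) ep)) eq))

  count-≤⇒included : (P Q : X → Bool) (xs : List X) → Included P Q xs → count Q xs ≤ count P xs → Included Q P xs
  count-≤⇒included P Q (y ∷ xs) i le x m qx with P y in ep | Q y in eq
  ... | true | false = ⊥-elim (true≢false (trans (sym (i y (here refl) ep)) eq))
  count-≤⇒included P Q (y ∷ xs) i le x (here refl) qx | true | true = ep
  count-≤⇒included P Q (y ∷ xs) i le x (there m) qx | true | true =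
    count-≤⇒included P Q xs (λ z m → i z (there m)) (s≤s⁻¹ le) x m qx
  count-≤⇒included P Q (y ∷ xs) i le x m qx | false | true =
    ⊥-elim (<⇒≱ (s≤s (count-mono P Q xs (λ z m → i z (there m)))) le)
  count-≤⇒included P Q (y ∷ xs) i le x (here refl) qx | false | false = ⊥-elim (true≢false (trans (sym qx) eq))
  count-≤⇒included P Q (y ∷ xs) i le x (there m) qx | false | false =
    count-≤⇒included P Q xs (λ z m → i z (there m)) le x m qx

-- Each
-- P-element is removed from Q in turn (`without`), which needs decidable equality.
module _ {Y : Set} (_≟ʸ_ : DecidableEquality Y) where

  private
    without : (Y → Bool) → Y → Y → Bool
    without Q y v = Q v ∧ not (does (v ≟ʸ y))

    without⊆ : ∀ Q y v → without Q y v ≡ true → Q v ≡ true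
    without⊆ Q y v e with Q v
    ... | true  = refl

    count-without : (Q : Y → Bool) (ys : List Y) (y : Y) → y ∈ ys → Q y ≡ true →
      suc (count (without Q y) ys) ≤ count Q ys
    count-without Q (z ∷ ys) y (here refl) qy with Q z | z ≟ʸ z
    ... | true  | yes _ = s≤s (count-mono (without Q z) Q ys (λ v _ → without⊆ Q z v))
    ... | true  | no z≢z = ⊥-elim (z≢z refl)
    count-without Q (z ∷ ys) y (here refl) () | false | _
    count-without Q (z ∷ ys) y (there m) qy with Q z | z ≟ʸ y
    ... | true  | yes _ = s≤s (count-mono (without Q y) Q ys (λ v _ → without⊆ Q y v))
    ... | true  | no _  = s≤s (count-without Q ys y m qy)
    ... | false | _     = count-without Q ys y m qy

  count-injection : {X : Set} (φ : X → Y) (P : X → Bool) (Q : Y → Bool) (xs : List X) (ys : List Y) →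
    Unique xs →
    (∀ x → x ∈ xs → P x ≡ true → (φ x ∈ ys) × (Q (φ x) ≡ true)) →
    (∀ x x' → x ∈ xs → x' ∈ xs → P x ≡ true → P x' ≡ true → φ x ≡ φ x' → x ≡ x') →
    count P xs ≤ count Q ys
  count-injection φ P Q [] ys _ _ _ = z≤n
  count-injection φ P Q (x ∷ xs) ys (x∉xs ∷ u) maps inj with P x in px
  ... | false = count-injection φ P Q xs ys u (λ z m → maps z (there m)) (λ z z' m m' → inj z z' (there m) (there m'))
  ... | true  = ≤-trans (s≤s rest) (count-without Q ys (φ x) (proj₁ (maps x (here refl) px)) (proj₂ (maps x (here refl) px)))
    where
    maps' : ∀ z → z ∈ xs → P z ≡ true → (φ z ∈ ys) × (without Q (φ x) (φ z) ≡ true)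
    maps' z m pz with maps z (there m) pz | φ z ≟ʸ φ x
    ... | _ , _ | yes e = ⊥-elim (All.lookup x∉xs m (sym (inj z x (there m) (here refl) pz px e)))
    ... | mz , qz | no _ rewrite qz = mz , refl
    rest : count P xs ≤ count (without Q (φ x)) ys
    rest = count-injection φ P (without Q (φ x)) xs ys u maps' (λ z z' m m' → inj z z' (there m) (there m'))

module _ {X Z : Set} where

  private
    count-++ : (R : X × Z → Bool) (as bs : List (X × Z)) → count R (as ++ bs) ≡ count R as + count R bs
    count-++ R [] bs = refl
    count-++ R (a ∷ as) bs with R a
    ... | true  = cong suc (count-++ R as bs)
    ... | false = count-++ R as bs

    count-map : (R : X × Z → Bool) (f : Z → X × Z) (zs : List Z) → count R (map f zs) ≡ count (λ z → R (f z)) zs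
    count-map R f [] = refl
    count-map R f (z ∷ zs) with R (f z)
    ... | true  = cong suc (count-map R f zs)
    ... | false = count-map R f zs

    count-false : (zs : List Z) → count (λ _ → false) zs ≡ 0
    count-false [] = refl
    count-false (z ∷ zs) = count-false zs

  count-cartesianProduct : (P : X → Bool) (Q : Z → Bool) (xs : List X) (zs : List Z) →
    count (λ p → P (proj₁ p) ∧ Q (proj₂ p)) (cartesianProduct xs zs) ≡ count P xs * count Q zs
  count-cartesianProduct P Q [] zs = refl
  count-cartesianProduct P Q (x ∷ xs) zs =
    trans (count-++ R (map (x ,_) zs) (cartesianProduct xs zs))
      (trans (cong₂ _+_ (count-map R (x ,_) zs) (count-cartesianProduct P Q xs zs)) row)
    where
    R : X × Z → Bool
    R p = P (proj₁ p) ∧ Q (proj₂ p)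
    row : count (λ z → P x ∧ Q z) zs + count P xs * count Q zs ≡ count P (x ∷ xs) * count Q zs
    row with P x
    ... | true  = refl
    ... | false = cong (_+ count P xs * count Q zs) (count-false zs)

count-allFin : (n : ℕ) → count (λ _ → true) (allFin n) ≡ n
count-allFin n = trans (count-length (allFin n)) (length-tabulate _)
  where
  count-length : {X : Set} (xs : List X) → count (λ _ → true) xs ≡ length xs
  count-length [] = refl
  count-length (x ∷ xs) = cong suc (count-length xs)

module _ {X : Set} {P : X → Set} (P? : ∀ x → Dec (P x)) where

  refinements : List X → List (Refinement X P)
  refinements [] = []
  refinements (x ∷ xs) with P? x
  ... | yes p = (x , [ p ]) ∷ refinements xs
  ... | no _  = refinements xs

  refinements-complete : ∀ {xs} (w : Refinement X P) → value w ∈ xs → w ∈ refinements xs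
  refinements-complete {x ∷ xs} (x , [ p ]) (here refl) with P? x
  ... | yes _  = here refl
  ... | no ¬p = ⊥-elim (¬p (recompute (P? x) p))
  refinements-complete {x ∷ xs} w (there m) with P? x
  ... | yes _ = there (refinements-complete w m)
  ... | no _  = refinements-complete w m

-- A finite group G, given by a complete list of its elements, with the operations
-- needed to speak of its actions (no group axiom is used beyond the action laws).
record FiniteGroup : Set₁ where
  infixl 7 _·_
  infix  8 _⁻¹
  field
    G        : Set
    elements : List G
    complete : ∀ g → g ∈ elements
    _·_      : G → G → G
    _⁻¹      : G → G
    ε        : G

module GroupAction (𝔾 : FiniteGroup) where
  open FiniteGroup 𝔾

  record Action (n : ℕ) : Set where
    field
      act     : G → Fin n → Fin n
      act-⁻¹ˡ : ∀ g u → act (g ⁻¹) (act g u) ≡ u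
      act-⁻¹ʳ : ∀ g u → act g (act (g ⁻¹) u) ≡ u
      act-·   : ∀ g h u → act (g · h) u ≡ act g (act h u)
      act-ε   : ∀ u → act ε u ≡ u

  fixedBy : ∀ {n} → Action n → List G → Fin n → Bool
  fixedBy S K u = does (all? (λ k → Action.act S k u ≟ u) K)

  fixedBy-elim : ∀ {n} (S : Action n) {K u} → fixedBy S K u ≡ true → ∀ {k} → k ∈ K → Action.act S k u ≡ u
  fixedBy-elim S {K} e = All.lookup (does⇒ (all? _ K) e)

  fixedBy-intro : ∀ {n} (S : Action n) {K u} → (∀ {k} → k ∈ K → Action.act S k u ≡ u) → fixedBy S K u ≡ true
  fixedBy-intro S {K} h = dec-true (all? _ K) (All.tabulate h)

  -- From now on C is a fixed action; every other action S is considered through the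
  -- diagonal action on Fin n × Fin c, which commutes with the projection to Fin c.
  module Fibred {c : ℕ} (C : Action c) where
    module C = Action C

    module Points {n : ℕ} (S : Action n) where
      open Action S

      Pt : Set
      Pt = Fin n × Fin c

      infixr 5 _•_
      _•_ : G → Pt → Pt
      g • (u , z) = act g u , C.act g z

      •-⁻¹ˡ : ∀ g p → g ⁻¹ • g • p ≡ p
      •-⁻¹ˡ g (u , z) = cong₂ _,_ (act-⁻¹ˡ g u) (C.act-⁻¹ˡ g z)

      •-⁻¹ʳ : ∀ g p → g • g ⁻¹ • p ≡ p
      •-⁻¹ʳ g (u , z) = cong₂ _,_ (act-⁻¹ʳ g u) (C.act-⁻¹ʳ g z)

      •-· : ∀ g h p → (g · h) • p ≡ g • h • p
      •-· g h (u , z) = cong₂ _,_ (act-· g h u) (C.act-· g h z)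

      •-ε : ∀ p → ε • p ≡ p
      •-ε (u , z) = cong₂ _,_ (act-ε u) (C.act-ε z)

      infix 4 _≟ₚ_
      _≟ₚ_ : DecidableEquality Pt
      _≟ₚ_ = ≡-dec _≟_ _≟_

      allPts : List Pt
      allPts = cartesianProduct (allFin n) (allFin c)

      allPts-complete : ∀ p → p ∈ allPts
      allPts-complete (u , z) = ∈-cartesianProduct⁺ (∈-allFin u) (∈-allFin z)

      agree⇒fix : ∀ {g₁ g₂ p} → g₁ • p ≡ g₂ • p → (g₂ ⁻¹ · g₁) • p ≡ p
      agree⇒fix {g₁} {g₂} {p} e = begin
        (g₂ ⁻¹ · g₁) • p  ≡⟨ •-· (g₂ ⁻¹) g₁ p ⟩
        g₂ ⁻¹ • g₁ • p    ≡⟨ cong (g₂ ⁻¹ •_) e ⟩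
        g₂ ⁻¹ • g₂ • p    ≡⟨ •-⁻¹ˡ g₂ p ⟩
        p                 ∎
        where open ≡-Reasoning

      fix⇒agree : ∀ {g₁ g₂ p} → (g₂ ⁻¹ · g₁) • p ≡ p → g₁ • p ≡ g₂ • p
      fix⇒agree {g₁} {g₂} {p} e = begin
        g₁ • p                ≡⟨ sym (•-⁻¹ʳ g₂ _) ⟩
        g₂ • g₂ ⁻¹ • g₁ • p   ≡⟨ cong (g₂ •_) (sym (•-· (g₂ ⁻¹) g₁ p)) ⟩
        g₂ • (g₂ ⁻¹ · g₁) • p ≡⟨ cong (g₂ •_) e ⟩
        g₂ • p                ∎
        where open ≡-Reasoning

      fixes : G → Pt → Bool
      fixes g p = does (g • p ≟ₚ p)

      fixes-elim : ∀ {g p} → fixes g p ≡ true → g • p ≡ p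
      fixes-elim = does⇒ (_ ≟ₚ _)

      fixes-intro : ∀ {g p} → g • p ≡ p → fixes g p ≡ true
      fixes-intro = dec-true (_ ≟ₚ _)

      stabSize : Pt → ℕ
      stabSize p = count (λ g → fixes g p) elements

      maxStab : (X : Pt → Bool) {p : Pt} → X p ≡ true →
        Σ Pt λ m → X m ≡ true × (∀ q → X q ≡ true → stabSize q ≤ stabSize m)
      maxStab X {p} xp = m , argmax-all stabSize xp (all-filter X? allPts) , largest
        where
        X? : ∀ q → Dec (X q ≡ true)
        X? q = X q ≟ᵇ true
        m : Pt
        m = argmax stabSize p (filter X? allPts)
        largest : ∀ q → X q ≡ true → stabSize q ≤ stabSize m
        largest q xq = All.lookup (f[xs]≤f[argmax] p (filter X? allPts)) (∈-filter⁺ X? (allPts-complete q) xq)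

      Invariant : (Pt → Bool) → Set
      Invariant X = ∀ g p → X p ≡ true → X (g • p) ≡ true

      orbit? : (x p : Pt) → Dec (Any (λ g → g • x ≡ p) elements)
      orbit? x p = any? (λ g → g • x ≟ₚ p) elements

      inOrbit : Pt → Pt → Bool
      inOrbit x p = does (orbit? x p)

      inOrbit-intro : ∀ {x p} g → g • x ≡ p → inOrbit x p ≡ true
      inOrbit-intro g e = dec-true (orbit? _ _) (lose (complete g) e)

      inOrbit-elim : ∀ {x p} → inOrbit x p ≡ true → Σ G λ g → g • x ≡ p
      inOrbit-elim {x} {p} e = let (g , _ , gx) = find (does⇒ (orbit? x p) e) in g , gx

      inOrbit-self : ∀ x → inOrbit x x ≡ true
      inOrbit-self x = inOrbit-intro ε (•-ε x)

      inOrbit-invariant : ∀ x → Invariant (inOrbit x)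
      inOrbit-invariant x g p e =
        let (h , hx) = inOrbit-elim e in inOrbit-intro (g · h) (trans (•-· g h x) (cong (g •_) hx))

      outOfOrbit-invariant : ∀ x g {p} → inOrbit x p ≡ false → inOrbit x (g • p) ≡ false
      outOfOrbit-invariant x g {p} out with inOrbit x (g • p) in o
      ... | false = refl
      ... | true  = ⊥-elim (true≢false (trans (sym back) out))
        where
        back : inOrbit x p ≡ true
        back = subst (λ q → inOrbit x q ≡ true) (•-⁻¹ˡ g p) (inOrbit-invariant x (g ⁻¹) (g • p) o)

      inOrbit-⊆ : ∀ {X x p} → Invariant X → X x ≡ true → inOrbit x p ≡ true → X p ≡ true
      inOrbit-⊆ {X} {x} iX xX e = let (g , gx) = inOrbit-elim e in subst (λ q → X q ≡ true) gx (iX g x xX)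

      fibreCount : (Pt → Bool) → Fin c → List G → ℕ
      fibreCount X z K = count (λ u → X (u , z) ∧ fixedBy S K u) (allFin n)

      _∖orbit_ : (Pt → Bool) → Pt → Pt → Bool
      (X ∖orbit x) p = X p ∧ not (inOrbit x p)

      ∖orbit-invariant : ∀ {X} → Invariant X → ∀ x → Invariant (X ∖orbit x)
      ∖orbit-invariant {X} iX x g p e =
        ∧-not-intro (iX g p (∧-elimˡ e)) (outOfOrbit-invariant x g (∧-not-elimʳ {X p} e))

      fibreCount-split : ∀ {X x} → Invariant X → X x ≡ true → ∀ z K →
        fibreCount X z K ≡ fibreCount (inOrbit x) z K + fibreCount (X ∖orbit x) z K
      fibreCount-split {X} {x} iX xX z K =
        trans (count-split (λ u → X (u , z) ∧ fixedBy S K u) (λ u → inOrbit x (u , z)) (allFin n))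
          (cong₂ _+_
            (count-cong _ _ (allFin n) (λ u _ → ∧-restrict (X (u , z)) (fixedBy S K u) (inOrbit x (u , z)) (inOrbit-⊆ iX xX)))
            (count-cong _ _ (allFin n) (λ u _ → ∧-remove (X (u , z)) (fixedBy S K u) (inOrbit x (u , z)))))

      ∖orbit-shrinks : ∀ {X x} → X x ≡ true → count (X ∖orbit x) allPts < count X allPts
      ∖orbit-shrinks {X} {x} xX = subst (count (X ∖orbit x) allPts <_) (sym (count-split X (inOrbit x) allPts))
        (≤-trans (s≤s (m≤n+m _ _)) (+-monoˡ-≤ _ (count-pos _ allPts (allPts-complete x) (∧-intro xX (inOrbit-self x)))))

      fixedPoint : List G → Pt → Bool
      fixedPoint K p = fixedBy S K (proj₁ p) ∧ fixedBy C K (proj₂ p)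

      fixedPoint-elim : ∀ {K p} → fixedPoint K p ≡ true → ∀ {k} → k ∈ K → k • p ≡ p
      fixedPoint-elim {K} {u , z} e k∈ =
        cong₂ _,_ (fixedBy-elim S (∧-elimˡ e) k∈) (fixedBy-elim C (∧-elimʳ {fixedBy S K u} e) k∈)

      fixedPoint-intro : ∀ {K p} → (∀ {k} → k ∈ K → k • p ≡ p) → fixedPoint K p ≡ true
      fixedPoint-intro h = ∧-intro (fixedBy-intro S (λ k∈ → cong proj₁ (h k∈))) (fixedBy-intro C (λ k∈ → cong proj₂ (h k∈)))

    module Transfer {m n : ℕ} (S : Action m) (T : Action n) where
      module S = Points S
      module T = Points T

      SameStab : S.Pt → T.Pt → Set
      SameStab x y = ∀ g → S.fixes g x ≡ T.fixes g y

      fix-transfer : ∀ {x y g} → SameStab x y → g S.• x ≡ x → g T.• y ≡ y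
      fix-transfer {g = g} se fx = T.fixes-elim (trans (sym (se g)) (S.fixes-intro fx))

      fix-transfer⁻ : ∀ {x y g} → SameStab x y → g T.• y ≡ y → g S.• x ≡ x
      fix-transfer⁻ {g = g} se fy = S.fixes-elim (trans (se g) (T.fixes-intro fy))

      orbit-agree : ∀ {x y g₁ g₂} → SameStab x y → g₁ S.• x ≡ g₂ S.• x → g₁ T.• y ≡ g₂ T.• y
      orbit-agree se e = T.fix⇒agree (fix-transfer se (S.agree⇒fix e))

      orbit-agree⁻ : ∀ {x y g₁ g₂} → SameStab x y → g₁ T.• y ≡ g₂ T.• y → g₁ S.• x ≡ g₂ S.• x
      orbit-agree⁻ se e = S.fix⇒agree (fix-transfer⁻ se (T.agree⇒fix e))

      orbit-fix : ∀ {x y k g} → SameStab x y → k S.• g S.• x ≡ g S.• x → k T.• g T.• y ≡ g T.• y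
      orbit-fix {x} {y} {k} {g} se e = trans (sym (T.•-· k g y)) (orbit-agree se (trans (S.•-· k g x) e))

      orbitMap : S.Pt → T.Pt → S.Pt → T.Pt
      orbitMap x y p with S.orbit? x p
      ... | yes w = proj₁ (find w) T.• y
      ... | no _  = y

      orbitMap-spec : ∀ {x y p} g → SameStab x y → g S.• x ≡ p → orbitMap x y p ≡ g T.• y
      orbitMap-spec {x} {y} {p} g se gx with S.orbit? x p
      ... | yes w = let (h , _ , hx) = find w in orbit-agree se (trans hx (sym gx))
      ... | no ¬w = ⊥-elim (¬w (lose (complete g) gx))

      SameMarks : (S.Pt → Bool) → (T.Pt → Bool) → Set
      SameMarks X Y = ∀ K z → fixedBy C K z ≡ true → S.fibreCount X z K ≡ T.fibreCount Y z K

      -- A point x of X has a partner in the same fibre of Y fixed by the whole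
      -- stabiliser of x: count the points fixed by that stabiliser.
      partner : ∀ {X Y} → SameMarks X Y → ∀ {x} → X x ≡ true →
        Σ (Fin n) λ v → Y (v , proj₂ x) ≡ true × (∀ g → S.fixes g x ≡ true → T.fixes g (v , proj₂ x) ≡ true)
      partner {X} {Y} marks {u , z} xX = v , ∧-elimˡ vY , stab⊆
        where
        stab? : ∀ g → Dec (g S.• (u , z) ≡ (u , z))
        stab? g = g S.• (u , z) S.≟ₚ (u , z)
        K : List G
        K = filter stab? elements
        K-fixes : ∀ {k} → k ∈ K → k S.• (u , z) ≡ (u , z)
        K-fixes k∈ = proj₂ (∈-filter⁻ stab? {xs = elements} k∈)
        pos : 0 < T.fibreCount Y z K
        pos = subst (0 <_) (marks K z (fixedBy-intro C (λ k∈ → cong proj₂ (K-fixes k∈))))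
          (count-pos _ (allFin m) (∈-allFin u) (∧-intro xX (fixedBy-intro S (λ k∈ → cong proj₁ (K-fixes k∈)))))
        w : Σ (Fin n) λ v → v ∈ allFin n × (Y (v , z) ∧ fixedBy T K v ≡ true)
        w = count-witness _ (allFin n) pos
        v : Fin n
        v = proj₁ w
        vY : Y (v , z) ∧ fixedBy T K v ≡ true
        vY = proj₂ (proj₂ w)
        stab⊆ : ∀ g → S.fixes g (u , z) ≡ true → T.fixes g (v , z) ≡ true
        stab⊆ g fx = T.fixes-intro (cong₂ _,_
          (fixedBy-elim T (∧-elimʳ {Y (v , z)} vY) (∈-filter⁺ stab? (complete g) (S.fixes-elim fx)))
          (cong proj₂ (S.fixes-elim fx)))

      matchingPoint : ∀ {X Y} → SameMarks X Y → ∀ {x} → X x ≡ true →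
        (∀ q → Y q ≡ true → T.stabSize q ≤ S.stabSize x) →
        Σ (Fin n) λ v → Y (v , proj₂ x) ≡ true × SameStab x (v , proj₂ x)
      matchingPoint marks xX maximal =
        let (v , vY , stab⊆) = partner marks xX
            stab⊇ = count-≤⇒included _ _ elements (λ g _ → stab⊆ g) (maximal _ vY)
        in v , vY , λ g → bool-ext (stab⊆ g) (stab⊇ g (complete g))

      -- On each fibre, the orbit map injects the K-fixed points of the orbit of x
      -- into the K-fixed points of the orbit of y.
      orbitCount-≤ : ∀ {u₀ v₀ z₀} → SameStab (u₀ , z₀) (v₀ , z₀) → ∀ K z → fixedBy C K z ≡ true →
        S.fibreCount (S.inOrbit (u₀ , z₀)) z K ≤ T.fibreCount (T.inOrbit (v₀ , z₀)) z K
      orbitCount-≤ {u₀} {v₀} {z₀} se K z zK =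
        count-injection _≟_ φ _ _ (allFin m) (allFin n) (allFin⁺ m) maps injective
        where
        x : S.Pt
        x = u₀ , z₀
        y : T.Pt
        y = v₀ , z₀
        φ : Fin m → Fin n
        φ u = proj₁ (orbitMap x y (u , z))
        image : ∀ {u} g → g S.• x ≡ (u , z) → g T.• y ≡ (φ u , z)
        image g gx = cong₂ _,_ (cong proj₁ (sym (orbitMap-spec g se gx))) (cong proj₂ gx)
        φ-fixed : ∀ {u} g → g S.• x ≡ (u , z) → fixedBy S K u ≡ true → ∀ {k} → k ∈ K → k T.• (φ u , z) ≡ (φ u , z)
        φ-fixed {u} g gx uK {k} k∈ = begin
          k T.• (φ u , z)  ≡⟨ cong (k T.•_) (sym (image g gx)) ⟩
          k T.• g T.• y    ≡⟨ orbit-fix se (trans (cong (k S.•_) gx) (trans k-fixes (sym gx))) ⟩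
          g T.• y          ≡⟨ image g gx ⟩
          (φ u , z)        ∎
          where
          open ≡-Reasoning
          k-fixes : k S.• (u , z) ≡ (u , z)
          k-fixes = cong₂ _,_ (fixedBy-elim S uK k∈) (fixedBy-elim C zK k∈)
        maps : ∀ u → u ∈ allFin m → S.inOrbit x (u , z) ∧ fixedBy S K u ≡ true →
          (φ u ∈ allFin n) × (T.inOrbit y (φ u , z) ∧ fixedBy T K (φ u) ≡ true)
        maps u _ e =
          let (g , gx) = S.inOrbit-elim (∧-elimˡ e) in
          ∈-allFin _ , ∧-intro (T.inOrbit-intro g (image g gx))
            (fixedBy-intro T (λ k∈ → cong proj₁ (φ-fixed g gx (∧-elimʳ {S.inOrbit x (u , z)} e) k∈)))
        injective : ∀ u₁ u₂ → u₁ ∈ allFin m → u₂ ∈ allFin m →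
          S.inOrbit x (u₁ , z) ∧ fixedBy S K u₁ ≡ true → S.inOrbit x (u₂ , z) ∧ fixedBy S K u₂ ≡ true →
          φ u₁ ≡ φ u₂ → u₁ ≡ u₂
        injective u₁ u₂ _ _ e₁ e₂ eφ =
          let (g₁ , g₁x) = S.inOrbit-elim (∧-elimˡ e₁)
              (g₂ , g₂x) = S.inOrbit-elim (∧-elimˡ e₂)
              same-y = trans (image g₁ g₁x) (trans (cong (_, z) eφ) (sym (image g₂ g₂x)))
          in cong proj₁ (trans (sym g₁x) (trans (orbit-agree⁻ se same-y) g₂x))

      -- An equivariant injection maps K-fixed points to K-fixed points, so T has at
      -- least as many of them as S.
      fixedCount-≤ : (F : S.Pt → T.Pt) → (∀ g p → F (g S.• p) ≡ g T.• F p) → (∀ p p' → F p ≡ F p' → p ≡ p') →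
        ∀ K → count (S.fixedPoint K) S.allPts ≤ count (T.fixedPoint K) T.allPts
      fixedCount-≤ F equivariant injective K =
        count-injection T._≟ₚ_ F _ _ S.allPts T.allPts (cartesianProduct⁺ (allFin⁺ m) (allFin⁺ c))
          (λ p _ pK → T.allPts-complete (F p) ,
            T.fixedPoint-intro {K} (λ {k} k∈ → trans (sym (equivariant k p)) (cong F (S.fixedPoint-elim {K} pK k∈))))
          (λ p p' _ _ _ _ → injective p p')

    module Matching {a b : ℕ} (A : Action a) (B : Action b) where
      module A = Points A
      module B = Points B
      module AB = Transfer A B
      module BA = Transfer B A
      open AB using (SameStab; SameMarks)

      -- An equivariant injection of X into Y over C (its values off X are irrelevant).
      record PartialMatch (X : A.Pt → Bool) (Y : B.Pt → Bool) : Set where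
        field
          h           : A.Pt → B.Pt
          maps-into   : ∀ p → X p ≡ true → Y (h p) ≡ true
          over-C      : ∀ p → X p ≡ true → proj₂ (h p) ≡ proj₂ p
          equivariant : ∀ g p → X p ≡ true → h (g A.• p) ≡ g B.• h p
          injective   : ∀ p p' → X p ≡ true → X p' ≡ true → h p ≡ h p' → p ≡ p'

      MatchedPair : (A.Pt → Bool) → (B.Pt → Bool) → Set
      MatchedPair X Y = Σ A.Pt λ x → Σ (Fin b) λ v → X x ≡ true × Y (v , proj₂ x) ≡ true × SameStab x (v , proj₂ x)

      -- Two sets with the same marks, X nonempty, contain a matched pair: take a point with
      -- a largest stabiliser in X or in Y and its partner on the other side.
      choosePair : ∀ {X Y} → SameMarks X Y → ∀ {p} → X p ≡ true → MatchedPair X Y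
      choosePair {X} {Y} marks xp
        with (xm , xmX , xmax) ← A.maxStab X xp
        with (v , vY , _) ← AB.partner marks xmX
        with ((vm , zm) , ymY , ymax) ← B.maxStab Y vY
        with B.stabSize (vm , zm) ≤? A.stabSize xm
      ... | yes ym≤xm =
        let (v' , v'Y , se) = AB.matchingPoint marks xmX (λ q yq → ≤-trans (ymax q yq) ym≤xm)
        in xm , v' , xmX , v'Y , se
      ... | no ym≰xm =
        let (u , uX , se) = BA.matchingPoint (λ K z zK → sym (marks K z zK)) ymY
                              (λ q xq → <⇒≤ (≤-<-trans (xmax q xq) (≰⇒> ym≰xm)))
        in (u , zm) , vm , uX , ymY , λ g → sym (se g)

      -- Then X ∖ Gx and Y ∖ Gy still have the same marks, and a
      -- match of the remainders extends to a match of X and Y by g • x ↦ g • y.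
      module PeelOrbit {X Y} (iX : A.Invariant X) (iY : B.Invariant Y) (marks : SameMarks X Y)
                       {u₀ z₀ v₀} (xX : X (u₀ , z₀) ≡ true) (yY : Y (v₀ , z₀) ≡ true)
                       (se : SameStab (u₀ , z₀) (v₀ , z₀)) where
        x : A.Pt
        x = u₀ , z₀
        y : B.Pt
        y = v₀ , z₀

        X′ : A.Pt → Bool
        X′ = X A.∖orbit x
        Y′ : B.Pt → Bool
        Y′ = Y B.∖orbit y

        iX′ : A.Invariant X′
        iX′ = A.∖orbit-invariant iX x
        iY′ : B.Invariant Y′
        iY′ = B.∖orbit-invariant iY y

        -- The orbits of x and y have the same marks (orbit maps inject both ways) ...
        orbits-sameMarks : SameMarks (A.inOrbit x) (B.inOrbit y)
        orbits-sameMarks K z zK =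
          ≤-antisym (AB.orbitCount-≤ se K z zK) (BA.orbitCount-≤ (λ g → sym (se g)) K z zK)

        marks′ : SameMarks X′ Y′
        marks′ K z zK = +-cancelˡ-≡ (A.fibreCount (A.inOrbit x) z K) _ _ (begin
          A.fibreCount (A.inOrbit x) z K + A.fibreCount X′ z K  ≡⟨ sym (A.fibreCount-split iX xX z K) ⟩
          A.fibreCount X z K                                    ≡⟨ marks K z zK ⟩
          B.fibreCount Y z K                                    ≡⟨ B.fibreCount-split iY yY z K ⟩
          B.fibreCount (B.inOrbit y) z K + B.fibreCount Y′ z K  ≡⟨ cong (_+ B.fibreCount Y′ z K) (sym (orbits-sameMarks K z zK)) ⟩
          A.fibreCount (A.inOrbit x) z K + B.fibreCount Y′ z K  ∎)
          where open ≡-Reasoning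

        shrinks : count X′ A.allPts < count X A.allPts
        shrinks = A.∖orbit-shrinks xX

        module Extend (R : PartialMatch X′ Y′) where
          module R = PartialMatch R

          extend : A.Pt → B.Pt
          extend p = if A.inOrbit x p then AB.orbitMap x y p else R.h p

          extend-orbit : ∀ g {p} → g A.• x ≡ p → extend p ≡ g B.• y
          extend-orbit g {p} gx =
            trans (cong (λ o → if o then AB.orbitMap x y p else R.h p) (A.inOrbit-intro g gx)) (AB.orbitMap-spec g se gx)

          extend-rest : ∀ {p} → A.inOrbit x p ≡ false → extend p ≡ R.h p
          extend-rest {p} out = cong (λ o → if o then AB.orbitMap x y p else R.h p) out

          rest-image : ∀ {p} → X p ≡ true → A.inOrbit x p ≡ false → B.inOrbit y (R.h p) ≡ false
          rest-image {p} xp out = ∧-not-elimʳ {Y (R.h p)} (R.maps-into p (∧-not-intro xp out))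

          maps-into : ∀ p → X p ≡ true → Y (extend p) ≡ true
          maps-into p xp with true-or-false (A.inOrbit x p)
          ... | inj₁ o = let (g , gx) = A.inOrbit-elim o in
                        subst (λ q → Y q ≡ true) (sym (extend-orbit g gx)) (iY g y yY)
          ... | inj₂ o = subst (λ q → Y q ≡ true) (sym (extend-rest o)) (∧-elimˡ (R.maps-into p (∧-not-intro xp o)))

          over-C : ∀ p → X p ≡ true → proj₂ (extend p) ≡ proj₂ p
          over-C p xp with true-or-false (A.inOrbit x p)
          ... | inj₁ o = let (g , gx) = A.inOrbit-elim o in trans (cong proj₂ (extend-orbit g gx)) (cong proj₂ gx)
          ... | inj₂ o = trans (cong proj₂ (extend-rest o)) (R.over-C p (∧-not-intro xp o))

          equivariant : ∀ g p → X p ≡ true → extend (g A.• p) ≡ g B.• extend p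
          equivariant g p xp with true-or-false (A.inOrbit x p)
          ... | inj₁ o = let (h , hx) = A.inOrbit-elim o in begin
            extend (g A.• p)  ≡⟨ extend-orbit (g · h) (trans (A.•-· g h x) (cong (g A.•_) hx)) ⟩
            (g · h) B.• y     ≡⟨ B.•-· g h y ⟩
            g B.• h B.• y     ≡⟨ cong (g B.•_) (sym (extend-orbit h hx)) ⟩
            g B.• extend p    ∎
            where open ≡-Reasoning
          ... | inj₂ o = begin
            extend (g A.• p)  ≡⟨ extend-rest (A.outOfOrbit-invariant x g o) ⟩
            R.h (g A.• p)     ≡⟨ R.equivariant g p (∧-not-intro xp o) ⟩
            g B.• R.h p       ≡⟨ cong (g B.•_) (sym (extend-rest o)) ⟩
            g B.• extend p    ∎
            where open ≡-Reasoning

          separated : ∀ {p p'} → A.inOrbit x p ≡ true → X p' ≡ true → A.inOrbit x p' ≡ false → extend p ≢ extend p'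
          separated {p} {p'} o xp' out e =
            let (g , gx) = A.inOrbit-elim o
                gy≡ = trans (sym (extend-orbit g gx)) (trans e (extend-rest out))
            in true≢false (trans (sym (B.inOrbit-intro g gy≡)) (rest-image xp' out))

          injective : ∀ p p' → X p ≡ true → X p' ≡ true → extend p ≡ extend p' → p ≡ p'
          injective p p' xp xp' e with true-or-false (A.inOrbit x p) | true-or-false (A.inOrbit x p')
          ... | inj₁ o | inj₁ o' =
            let (g , gx) = A.inOrbit-elim o
                (g' , g'x) = A.inOrbit-elim o'
            in trans (sym gx) (trans (AB.orbit-agree⁻ se (trans (sym (extend-orbit g gx)) (trans e (extend-orbit g' g'x)))) g'x)
          ... | inj₁ o | inj₂ o' = ⊥-elim (separated o xp' o' e)
          ... | inj₂ o | inj₁ o' = ⊥-elim (separated o' xp o (sym e))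
          ... | inj₂ o | inj₂ o' =
            R.injective p p' (∧-not-intro xp o) (∧-not-intro xp' o') (trans (sym (extend-rest o)) (trans e (extend-rest o')))

          extension : PartialMatch X Y
          extension = record
            { h = extend ; maps-into = maps-into ; over-C = over-C ; equivariant = equivariant ; injective = injective }

      emptyMatch : ∀ {X Y} → (A.Pt → B.Pt) → (∀ {p} → X p ≡ true → ⊥) → PartialMatch X Y
      emptyMatch default notX = record
        { h = default ; maps-into = λ p xp → ⊥-elim (notX xp) ; over-C = λ p xp → ⊥-elim (notX xp)
        ; equivariant = λ g p xp → ⊥-elim (notX xp) ; injective = λ p p' xp _ _ → ⊥-elim (notX xp) }

      -- Any two invariant sets with the same marks can be matched: peel off a pair of orbits
      -- and recurse, the fuel bounding the size of X; `default` fills the values off X.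
      match : (default : A.Pt → B.Pt) (fuel : ℕ) {X : A.Pt → Bool} {Y : B.Pt → Bool} → count X A.allPts ≤ fuel →
        A.Invariant X → B.Invariant Y → SameMarks X Y → PartialMatch X Y
      match default zero {X} bound iX iY marks =
        emptyMatch default (λ xp → <⇒≱ (count-pos X A.allPts (A.allPts-complete _) xp) bound)
      match default (suc fuel) {X} {Y} bound iX iY marks with any? (λ p → X p ≟ᵇ true) A.allPts
      ... | no empty = emptyMatch default (λ xp → empty (lose (A.allPts-complete _) xp))
      ... | yes some = peel (choosePair marks (proj₂ (proj₂ (find some))))
        where
        peel : MatchedPair X Y → PartialMatch X Y
        peel ((u₀ , z₀) , v₀ , xX , yY , se) =
          Peel.Extend.extension (match default fuel (s≤s⁻¹ (≤-trans Peel.shrinks bound)) Peel.iX′ Peel.iY′ Peel.marks′)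
          where module Peel = PeelOrbit iX iY marks xX yY se

      -- An equivariant bijection Fin a × Fin c ≅ Fin b × Fin c makes the whole spaces have
      -- the same marks: count fixed points on both sides and cancel the fixed points of C.
      bijection-sameMarks : (F : A.Pt → B.Pt) (F⁻¹ : B.Pt → A.Pt) → (∀ p → F⁻¹ (F p) ≡ p) → (∀ q → F (F⁻¹ q) ≡ q) →
        (∀ g p → F (g A.• p) ≡ g B.• F p) → SameMarks (λ _ → true) (λ _ → true)
      bijection-sameMarks F F⁻¹ left right equivariant K z zK =
        *-cancelʳ-≡ _ _ fixedC {{>-nonZero (count-pos (fixedBy C K) (allFin c) (∈-allFin z) zK)}} (begin
          count (fixedBy A K) (allFin a) * fixedC  ≡⟨ sym (count-cartesianProduct (fixedBy A K) (fixedBy C K) (allFin a) (allFin c)) ⟩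
          count (A.fixedPoint K) A.allPts          ≡⟨ ≤-antisym (AB.fixedCount-≤ F equivariant injective K)
                                                                (BA.fixedCount-≤ F⁻¹ equivariant⁻¹ injective⁻¹ K) ⟩
          count (B.fixedPoint K) B.allPts          ≡⟨ count-cartesianProduct (fixedBy B K) (fixedBy C K) (allFin b) (allFin c) ⟩
          count (fixedBy B K) (allFin b) * fixedC  ∎)
        where
        open ≡-Reasoning
        fixedC : ℕ
        fixedC = count (fixedBy C K) (allFin c)
        injective : ∀ p p' → F p ≡ F p' → p ≡ p'
        injective p p' e = trans (sym (left p)) (trans (cong F⁻¹ e) (left p'))
        injective⁻¹ : ∀ q q' → F⁻¹ q ≡ F⁻¹ q' → q ≡ q'
        injective⁻¹ q q' e = trans (sym (right q)) (trans (cong F e) (right q'))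
        equivariant⁻¹ : ∀ g q → F⁻¹ (g B.• q) ≡ g A.• F⁻¹ q
        equivariant⁻¹ g q = injective _ _ (trans (right (g B.• q)) (sym (trans (equivariant g (F⁻¹ q)) (cong (g B.•_) (right q)))))

-- Permutations of Fin n presented by the table of the permutation and the table of its
-- inverse; unlike Permutation′ n, these can be listed exhaustively.
record Table (n : ℕ) : Set where
  constructor table
  field
    fwd bwd : Vec (Fin n) n

module _ {n : ℕ} where

  ⟦_⟧ : Table n → Fin n → Fin n
  ⟦ π ⟧ u = lookup (Table.fwd π) u

  ⟦_⟧⁻¹ : Table n → Fin n → Fin n
  ⟦ π ⟧⁻¹ u = lookup (Table.bwd π) u

  IsPerm : Table n → Set
  IsPerm π = (∀ u → ⟦ π ⟧⁻¹ (⟦ π ⟧ u) ≡ u) × (∀ u → ⟦ π ⟧ (⟦ π ⟧⁻¹ u) ≡ u)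

  isPerm? : (π : Table n) → Dec (IsPerm π)
  isPerm? π = Fin.all? (λ u → ⟦ π ⟧⁻¹ (⟦ π ⟧ u) ≟ u) ×-dec Fin.all? (λ u → ⟦ π ⟧ (⟦ π ⟧⁻¹ u) ≟ u)

  idᵀ : Table n
  idᵀ = table (tabulate (λ u → u)) (tabulate (λ u → u))

  _∘ᵀ_ : Table n → Table n → Table n
  π ∘ᵀ ρ = table (tabulate (λ u → ⟦ π ⟧ (⟦ ρ ⟧ u))) (tabulate (λ u → ⟦ ρ ⟧⁻¹ (⟦ π ⟧⁻¹ u)))

  _⁻¹ᵀ : Table n → Table n
  table f b ⁻¹ᵀ = table b f

  ⟦id⟧ : ∀ u → ⟦ idᵀ ⟧ u ≡ u
  ⟦id⟧ = lookup∘tabulate (λ u → u)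

  ⟦∘⟧ : ∀ π ρ u → ⟦ π ∘ᵀ ρ ⟧ u ≡ ⟦ π ⟧ (⟦ ρ ⟧ u)
  ⟦∘⟧ π ρ = lookup∘tabulate _

  ⟦∘⟧⁻¹ : ∀ π ρ u → ⟦ π ∘ᵀ ρ ⟧⁻¹ u ≡ ⟦ ρ ⟧⁻¹ (⟦ π ⟧⁻¹ u)
  ⟦∘⟧⁻¹ π ρ = lookup∘tabulate _

  IsPerm-id : IsPerm idᵀ
  IsPerm-id = (λ u → trans (⟦id⟧ (⟦ idᵀ ⟧ u)) (⟦id⟧ u)) , (λ u → trans (⟦id⟧ (⟦ idᵀ ⟧ u)) (⟦id⟧ u))

  IsPerm-∘ : ∀ {π ρ} → IsPerm π → IsPerm ρ → IsPerm (π ∘ᵀ ρ)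
  IsPerm-∘ {π} {ρ} (πˡ , πʳ) (ρˡ , ρʳ) =
    (λ u → trans (⟦∘⟧⁻¹ π ρ _) (trans (cong (λ w → ⟦ ρ ⟧⁻¹ (⟦ π ⟧⁻¹ w)) (⟦∘⟧ π ρ u)) (trans (cong ⟦ ρ ⟧⁻¹ (πˡ _)) (ρˡ u)))) ,
    (λ u → trans (⟦∘⟧ π ρ _) (trans (cong (λ w → ⟦ π ⟧ (⟦ ρ ⟧ w)) (⟦∘⟧⁻¹ π ρ u)) (trans (cong ⟦ π ⟧ (ρʳ _)) (πʳ u))))

  IsPerm-⁻¹ : ∀ {π} → IsPerm π → IsPerm (π ⁻¹ᵀ)
  IsPerm-⁻¹ {table f b} (l , r) = r , l

  fromPermutation : Permutation′ n → Table n
  fromPermutation π = table (tabulate (π ⟨$⟩ʳ_)) (tabulate (π ⟨$⟩ˡ_))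

  ⟦fromPermutation⟧ : ∀ π u → ⟦ fromPermutation π ⟧ u ≡ π ⟨$⟩ʳ u
  ⟦fromPermutation⟧ π = lookup∘tabulate _

  ⟦fromPermutation⟧⁻¹ : ∀ π u → ⟦ fromPermutation π ⟧⁻¹ u ≡ π ⟨$⟩ˡ u
  ⟦fromPermutation⟧⁻¹ π = lookup∘tabulate _

  IsPerm-fromPermutation : ∀ π → IsPerm (fromPermutation π)
  IsPerm-fromPermutation π =
    (λ u → trans (⟦fromPermutation⟧⁻¹ π _) (trans (cong (π ⟨$⟩ˡ_) (⟦fromPermutation⟧ π u)) (inverseˡ π))) ,
    (λ u → trans (⟦fromPermutation⟧ π _) (trans (cong (π ⟨$⟩ʳ_) (⟦fromPermutation⟧⁻¹ π u)) (inverseʳ π)))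

vectors : (n m : ℕ) → List (Vec (Fin n) m)
vectors n zero    = Vec.[] ∷ []
vectors n (suc m) = cartesianProductWith Vec._∷_ (allFin n) (vectors n m)

vectors-complete : ∀ {n m} (v : Vec (Fin n) m) → v ∈ vectors n m
vectors-complete Vec.[]       = here refl
vectors-complete (u Vec.∷ v) = ∈-cartesianProductWith⁺ Vec._∷_ (∈-allFin u) (vectors-complete v)

tables : (n : ℕ) → List (Table n)
tables n = cartesianProductWith table (vectors n n) (vectors n n)

tables-complete : ∀ {n} (π : Table n) → π ∈ tables n
tables-complete (table f b) = ∈-cartesianProductWith⁺ table (vectors-complete f) (vectors-complete b)

module Symmetries {a b c : ℕ} (F : Fin a × Fin c → Fin b × Fin c) where

  record Triple : Set where
    constructor ⟨_,_,_⟩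
    field
      α : Table a
      β : Table b
      γ : Table c
  open Triple

  infixl 7 _∘³_
  infix  8 _⁻¹³
  infixr 5 _•ᴬ_ _•ᴮ_

  _∘³_ : Triple → Triple → Triple
  s ∘³ t = ⟨ α s ∘ᵀ α t , β s ∘ᵀ β t , γ s ∘ᵀ γ t ⟩

  _⁻¹³ : Triple → Triple
  t ⁻¹³ = ⟨ α t ⁻¹ᵀ , β t ⁻¹ᵀ , γ t ⁻¹ᵀ ⟩

  id³ : Triple
  id³ = ⟨ idᵀ , idᵀ , idᵀ ⟩

  _•ᴬ_ : Triple → Fin a × Fin c → Fin a × Fin c
  t •ᴬ (u , z) = ⟦ α t ⟧ u , ⟦ γ t ⟧ z

  _•ᴮ_ : Triple → Fin b × Fin c → Fin b × Fin c
  t •ᴮ (v , z) = ⟦ β t ⟧ v , ⟦ γ t ⟧ z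

  Preserves : Triple → Set
  Preserves t = ∀ u z → F (t •ᴬ (u , z)) ≡ t •ᴮ F (u , z)

  IsSymmetry : Triple → Set
  IsSymmetry t = IsPerm (α t) × IsPerm (β t) × IsPerm (γ t) × Preserves t

  isSymmetry? : ∀ t → Dec (IsSymmetry t)
  isSymmetry? t = isPerm? (α t) ×-dec isPerm? (β t) ×-dec isPerm? (γ t) ×-dec
    Fin.all? (λ u → Fin.all? (λ z → ≡-dec _≟_ _≟_ (F (t •ᴬ (u , z))) (t •ᴮ F (u , z))))

  Preserves-∘ : ∀ {s t} → Preserves s → Preserves t → Preserves (s ∘³ t)
  Preserves-∘ {s} {t} ps pt u z = begin
    F ((s ∘³ t) •ᴬ (u , z))  ≡⟨ cong F (cong₂ _,_ (⟦∘⟧ (α s) (α t) u) (⟦∘⟧ (γ s) (γ t) z)) ⟩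
    F (s •ᴬ (t •ᴬ (u , z)))  ≡⟨ ps _ _ ⟩
    s •ᴮ F (t •ᴬ (u , z))    ≡⟨ cong (s •ᴮ_) (pt u z) ⟩
    s •ᴮ (t •ᴮ F (u , z))    ≡⟨ sym (cong₂ _,_ (⟦∘⟧ (β s) (β t) _) (⟦∘⟧ (γ s) (γ t) _)) ⟩
    (s ∘³ t) •ᴮ F (u , z)    ∎
    where open ≡-Reasoning

  Preserves-⁻¹ : ∀ {t} → IsSymmetry t → Preserves (t ⁻¹³)
  Preserves-⁻¹ {t} ((_ , αʳ) , (βˡ , _) , (γˡ , γʳ) , pt) u z = sym (begin
    t ⁻¹³ •ᴮ F (u , z)                    ≡⟨ cong (λ p → t ⁻¹³ •ᴮ F p) (sym (cong₂ _,_ (αʳ u) (γʳ z))) ⟩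
    t ⁻¹³ •ᴮ F (t •ᴬ (t ⁻¹³ •ᴬ (u , z))) ≡⟨ cong (t ⁻¹³ •ᴮ_) (pt _ _) ⟩
    t ⁻¹³ •ᴮ (t •ᴮ F (t ⁻¹³ •ᴬ (u , z))) ≡⟨ cong₂ _,_ (βˡ _) (γˡ _) ⟩
    F (t ⁻¹³ •ᴬ (u , z))                  ∎)
    where open ≡-Reasoning

  Preserves-id : Preserves id³
  Preserves-id u z = trans (cong F (cong₂ _,_ (⟦id⟧ u) (⟦id⟧ z))) (sym (cong₂ _,_ (⟦id⟧ _) (⟦id⟧ _)))

  IsSymmetry-∘ : ∀ {s t} → IsSymmetry s → IsSymmetry t → IsSymmetry (s ∘³ t)
  IsSymmetry-∘ {s} {t} (sα , sβ , sγ , sF) (tα , tβ , tγ , tF) =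
    IsPerm-∘ {π = α s} {α t} sα tα , IsPerm-∘ {π = β s} {β t} sβ tβ , IsPerm-∘ {π = γ s} {γ t} sγ tγ , Preserves-∘ {s} {t} sF tF

  IsSymmetry-⁻¹ : ∀ {t} → IsSymmetry t → IsSymmetry (t ⁻¹³)
  IsSymmetry-⁻¹ {t} st@(tα , tβ , tγ , _) =
    IsPerm-⁻¹ {π = α t} tα , IsPerm-⁻¹ {π = β t} tβ , IsPerm-⁻¹ {π = γ t} tγ , Preserves-⁻¹ {t} st

  Symmetry : Set
  Symmetry = Refinement Triple IsSymmetry

  isSymmetry : (g : Symmetry) → IsSymmetry (value g)
  isSymmetry (t , [ s ]) = recompute (isSymmetry? t) s

  symmetry : ∀ t → IsSymmetry t → Symmetry
  symmetry t s = t , [ s ]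

  triples : List Triple
  triples = cartesianProductWith (λ αβ γ → ⟨ proj₁ αβ , proj₂ αβ , γ ⟩) (cartesianProduct (tables a) (tables b)) (tables c)

  triples-complete : ∀ t → t ∈ triples
  triples-complete ⟨ α , β , γ ⟩ =
    ∈-cartesianProductWith⁺ _ (∈-cartesianProduct⁺ (tables-complete α) (tables-complete β)) (tables-complete γ)

  group : FiniteGroup
  group = record
    { G        = Symmetry
    ; elements = refinements isSymmetry? triples
    ; complete = λ g → refinements-complete isSymmetry? g (triples-complete (value g))
    ; _·_      = λ g h → symmetry (value g ∘³ value h) (IsSymmetry-∘ {value g} {value h} (isSymmetry g) (isSymmetry h))
    ; _⁻¹      = λ g → symmetry (value g ⁻¹³) (IsSymmetry-⁻¹ {value g} (isSymmetry g))
    ; ε        = symmetry id³ (IsPerm-id , IsPerm-id , IsPerm-id , Preserves-id)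
    }

  open GroupAction group

  componentAction : ∀ {n : ℕ} (π : Triple → Table n) → (∀ {t} → IsSymmetry t → IsPerm (π t)) →
    (∀ s t → π (s ∘³ t) ≡ π s ∘ᵀ π t) → (∀ t → π (t ⁻¹³) ≡ π t ⁻¹ᵀ) → π id³ ≡ idᵀ → Action n
  componentAction π perm ∘-hom ⁻¹-hom id-hom = record
    { act     = λ g → ⟦ π (value g) ⟧
    ; act-⁻¹ˡ = λ g u → trans (cong (λ τ → ⟦ τ ⟧ (⟦ π (value g) ⟧ u)) (⁻¹-hom (value g))) (proj₁ (perm (isSymmetry g)) u)
    ; act-⁻¹ʳ = λ g u → trans (cong (λ τ → ⟦ π (value g) ⟧ (⟦ τ ⟧ u)) (⁻¹-hom (value g))) (proj₂ (perm (isSymmetry g)) u)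
    ; act-·   = λ g h u → trans (cong (λ τ → ⟦ τ ⟧ u) (∘-hom (value g) (value h))) (⟦∘⟧ (π (value g)) (π (value h)) u)
    ; act-ε   = λ u → trans (cong (λ τ → ⟦ τ ⟧ u) id-hom) (⟦id⟧ u)
    }

  actionA : Action a
  actionA = componentAction α proj₁ (λ _ _ → refl) (λ _ → refl) refl

  actionB : Action b
  actionB = componentAction β (λ s → proj₁ (proj₂ s)) (λ _ _ → refl) (λ _ → refl) refl

  actionC : Action c
  actionC = componentAction γ (λ s → proj₁ (proj₂ (proj₂ s))) (λ _ _ → refl) (λ _ → refl) refl

  open Fibred actionC
  module A = Points actionA
  module B = Points actionB

  F-equivariant : ∀ g p → F (g A.• p) ≡ g B.• F p
  F-equivariant g (u , z) = proj₂ (proj₂ (proj₂ (isSymmetry g))) u z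

  permutationSymmetry : (α : Permutation′ a) (β : Permutation′ b) (γ : Permutation′ c) →
    twist F α β γ ≗ F → Symmetry
  permutationSymmetry α β γ fixes = symmetry t
    (IsPerm-fromPermutation α , IsPerm-fromPermutation β , IsPerm-fromPermutation γ , preserves)
    where
    open ≡-Reasoning
    t : Triple
    t = ⟨ fromPermutation α , fromPermutation β , fromPermutation γ ⟩
    preserves : Preserves t
    preserves u z = begin
      F (t •ᴬ (u , z))                                      ≡⟨ cong F (cong₂ _,_ (⟦fromPermutation⟧ α u) (⟦fromPermutation⟧ γ z)) ⟩
      F (α ⟨$⟩ʳ u , γ ⟨$⟩ʳ z)                               ≡⟨ sym (fixes _) ⟩
      twist F α β γ (α ⟨$⟩ʳ u , γ ⟨$⟩ʳ z)                   ≡⟨ cong (λ p → Product.map (β ⟨$⟩ʳ_) (γ ⟨$⟩ʳ_) (F p))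
                                                                    (cong₂ _,_ (inverseˡ α) (inverseˡ γ)) ⟩
      Product.map (β ⟨$⟩ʳ_) (γ ⟨$⟩ʳ_) (F (u , z))           ≡⟨ sym (cong₂ _,_ (⟦fromPermutation⟧ β _) (⟦fromPermutation⟧ γ _)) ⟩
      t •ᴮ F (u , z)                                        ∎

parallel : ∀ {a b c} → (Fin c → Fin a ↔ Fin b) → Bij a b c
parallel h = mk↔ₛ′
  (λ p → Inverse.to (h (proj₂ p)) (proj₁ p) , proj₂ p)
  (λ q → Inverse.from (h (proj₂ q)) (proj₁ q) , proj₂ q)
  (λ q → cong (_, proj₂ q) (Inverse.strictlyInverseˡ (h (proj₂ q)) (proj₁ q)))
  (λ p → cong (_, proj₂ p) (Inverse.strictlyInverseʳ (h (proj₂ p)) (proj₁ p)))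

parallel-isParallel : ∀ {a b c} (h : Fin c → Fin a ↔ Fin b) → IsParallel (parallel h)
parallel-isParallel h = h , λ x z → refl

-- An injection Fin m → Fin n with n ≤ m is onto: a missed value would let it
-- inject into Fin (n - 1).
injective⇒onto : ∀ {m n} → n ≤ m → (f : Fin m → Fin n) → (∀ {u u'} → f u ≡ f u' → u ≡ u') →
  ∀ v → Σ (Fin m) λ u → f u ≡ v
injective⇒onto {m} {suc n} n≤m f injective v with Fin.any? (λ u → f u ≟ v)
... | yes found  = found
... | no missing = ⊥-elim (<⇒≱ n≤m (Fin.injective⇒≤ punched-injective))
  where
  punched : Fin m → Fin n
  punched u = punchOut {i = v} {j = f u} (λ e → missing (u , sym e))
  punched-injective : ∀ {u u'} → punched u ≡ punched u' → u ≡ u'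
  punched-injective {u} {u'} e =
    injective (Fin.punchOut-injective {i = v} (λ e → missing (u , sym e)) (λ e → missing (u' , sym e)) e)

injective⇒↔ : ∀ {m n} → m ≡ n → (f : Fin m → Fin n) → (∀ {u u'} → f u ≡ f u' → u ≡ u') → Fin m ↔ Fin n
injective⇒↔ {m} m≡n f injective = mk↔ₛ′ f (λ v → proj₁ (onto v)) (λ v → proj₂ (onto v))
  (λ u → injective (proj₂ (onto (f u))))
  where
  onto : ∀ v → Σ (Fin m) λ u → f u ≡ v
  onto = injective⇒onto (≤-reflexive (sym m≡n)) f injective

-- The parallel bijection attached to f; the point z₀ of C is only used to see |A| = |B|.
module ParallelBar {a b c : ℕ} (f : Bij a b c) (z₀ : Fin c) where
  open Symmetries (app f)
  open GroupAction group using (module Fibred)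
  open Fibred actionC using (module Transfer; module Matching)
  open Transfer actionA actionB using (SameMarks)
  open Matching actionA actionB using (PartialMatch; match; bijection-sameMarks)

  marks : SameMarks (λ _ → true) (λ _ → true)
  marks = bijection-sameMarks (app f) (Inverse.from f) (Inverse.strictlyInverseʳ f) (Inverse.strictlyInverseˡ f) F-equivariant

  matching : PartialMatch (λ _ → true) (λ _ → true)
  matching = match (app f) (count (λ _ → true) A.allPts) ≤-refl (λ _ _ _ → refl) (λ _ _ _ → refl) marks
  module M = PartialMatch matching

  fibre : Fin c → Fin a → Fin b
  fibre z u = proj₁ (M.h (u , z))

  h-fibre : ∀ u z → M.h (u , z) ≡ (fibre z u , z)
  h-fibre u z = cong (fibre z u ,_) (M.over-C (u , z) refl)

  fibre-injective : ∀ z {u u'} → fibre z u ≡ fibre z u' → u ≡ u'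
  fibre-injective z {u} {u'} e =
    cong proj₁ (M.injective (u , z) (u' , z) refl refl (trans (h-fibre u z) (trans (cong (_, z) e) (sym (h-fibre u' z)))))

  -- The marks of the trivial subgroup over z₀ compare the sizes of A and B.
  a≡b : a ≡ b
  a≡b = trans (sym (count-allFin a)) (trans (marks [] z₀ refl) (count-allFin b))

  fibre↔ : Fin c → Fin a ↔ Fin b
  fibre↔ z = injective⇒↔ a≡b (fibre z) (fibre-injective z)

  fbar : Bij a b c
  fbar = parallel fibre↔

  isParallel : IsParallel fbar
  isParallel = parallel-isParallel fibre↔

  -- A twist fixing f is a symmetry g, and fbar is the matching, which commutes with g.
  equivariant : Equivariant f fbar
  equivariant α β γ fixes (x , z) = begin
    twist (app fbar) α β γ (x , z)   ≡⟨ cong₂ _,_ (sym (⟦fromPermutation⟧ β _)) (sym (⟦fromPermutation⟧ γ _)) ⟩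
    g B.• app fbar q                 ≡⟨ cong (g B.•_) (sym (h-fibre _ _)) ⟩
    g B.• M.h q                      ≡⟨ sym (M.equivariant g q refl) ⟩
    M.h (g A.• q)                    ≡⟨ cong M.h (cong₂ _,_ (trans (⟦fromPermutation⟧ α _) (inverseʳ α))
                                                              (trans (⟦fromPermutation⟧ γ _) (inverseʳ γ))) ⟩
    M.h (x , z)                      ≡⟨ h-fibre x z ⟩
    app fbar (x , z)                 ∎
    where
    open ≡-Reasoning
    g : Symmetry
    g = permutationSymmetry α β γ fixes
    q : Fin a × Fin c
    q = α ⟨$⟩ˡ x , γ ⟨$⟩ˡ z

proposition2 : (c : ℕ) → 1 ≤ c →
    Σ (∀ {a b} → Bij a b c → Bij a b c) λ bar →
    ∀ {a b} (f : Bij a b c) → IsParallel (bar f) × Equivariant f (bar f)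
proposition2 (suc c) _ =
  (λ f → ParallelBar.fbar f fzero) , λ f → ParallelBar.isParallel f fzero , ParallelBar.equivariant f fzero
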